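{- Let $k\ge1$ and let $F$ be a feasible solution of an instance $(G=(V,E),\mathscr{S},\mathscr{U},c)$ of $(1,k)$-FGC. Let $D=(V,A)$ be the digraph whose arc multiset is obtained as follows: for each unsafe edge $e=uv\in F\cap\mathscr{U}$ include one bidirected pair $\{(u,v),(v,u)\}$, and for each safe edge $e=uv\in F\cap\mathscr{S}$ include $k+1$ bidirected pairs $\{(u,v),(v,u)\}$; each arc gets the cost of the edge giving rise to it. Then for any $r\in V$, $D$ contains an $r$-rooted $(k+1)$-arborescence of cost at most $(k+1)c(F)$.
   Context: $(1,k)$-FGC: $G=(V,E)$ is an undirected connected multigraph without self-loops, $E=\mathscr{S}\,\dot\cup\,\mathscr{U}$ is a partition into safe and unsafe edges, $c:E\to\mathbb{R}_{\ge0}$. An edge-set $F\subseteq E$ is feasible if for every $F'\subseteq\mathscr{U}$ with $|F'|\le k$ the subgraph $(V,F\setminus F')$ is connected; $c(F)=\sum_{e\in F}c_e$. An $r$-rooted arborescence in a digraph $D=(W,A)$ is an arc set $T\subseteq A$ whose underlying undirected graph is acyclic and such that every $v\in W\setminus\{r\}$ is reachable from $r$ by a directed path in $(W,T)$. An $r$-rooted $j$-arborescence is an arc set that can be partitioned into $j$ arc-disjoint $r$-rooted arborescences; its cost is the sum of its arc costs.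
   Formalization: The edge costs $c$ are nonnegative rationals rather than nonnegative reals. -}

module Defs where

open import Data.Nat as ℕ using (ℕ; zero; suc)
open import Data.Fin using (Fin; _≟_)
open import Data.Fin.Properties using () renaming (_≟_ to _≟F_)
open import Data.Bool using (Bool; true; false; if_then_else_; _∧_; not)
open import Data.Product using (Σ; Σ-syntax; ∃; ∃-syntax; _×_; _,_; proj₁; proj₂)
open import Data.List using (List; []; _∷_; map; allFin; foldr)
open import Data.List.Relation.Unary.Unique.Propositional using (Unique)
open import Data.Integer using (+_)
open import Data.Rational using (ℚ; 0ℚ; _+_; _*_; _≤_; _/_)
open import Relation.Binary.PropositionalEquality using (_≡_)
open import Relation.Nullary using (¬_)
open import Relation.Nullary.Decidable using (⌊_⌋)

-- An instance of (1,k)-FGC on vertex set V = Fin n with edges indexed by Fin m.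
-- ends e = (u , v) are the endpoints of edge e (multigraph: parallel edges allowed);
-- safe e = true iff e ∈ 𝒮 (otherwise e ∈ 𝒰); cost c e ≥ 0.
record Instance (n m : ℕ) : Set where
  field
    ends : Fin m → Fin n × Fin n
    safe : Fin m → Bool
    cost : Fin m → ℚ

  tl hd : Fin m → Fin n
  tl e = proj₁ (ends e)
  hd e = proj₂ (ends e)

EdgeSet : ℕ → Set
EdgeSet m = Fin m → Bool

sumℚ : {A : Set} → List A → (A → ℚ) → ℚ
sumℚ xs f = foldr (λ x acc → f x + acc) 0ℚ xs

countB : {m : ℕ} → EdgeSet m → ℕ
countB {m} H = foldr (λ e acc → if H e then suc acc else acc) 0 (allFin m)

module _ {n m : ℕ} (I : Instance n m) where
  open Instance I

  data UReach (H : EdgeSet m) : Fin n → Fin n → Set where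
    here : ∀ v → UReach H v v
    fwd  : ∀ {v} (e : Fin m) → H e ≡ true → UReach H (hd e) v → UReach H (tl e) v
    bwd  : ∀ {v} (e : Fin m) → H e ≡ true → UReach H (tl e) v → UReach H (hd e) v

  ConnectedE : EdgeSet m → Set
  ConnectedE H = ∀ u v → UReach H u v

  NoSelfLoops : Set
  NoSelfLoops = ∀ e → ¬ (tl e ≡ hd e)

  NonNegCost : Set
  NonNegCost = ∀ e → 0ℚ ≤ cost e

  Feasible : ℕ → EdgeSet m → Set
  Feasible k F = (F' : EdgeSet m) → (∀ e → F' e ≡ true → safe e ≡ false) →
                 countB F' ℕ.≤ k → ConnectedE (λ e → F e ∧ not (F' e))

  costE : EdgeSet m → ℚ
  costE F = sumℚ (allFin m) (λ e → if F e then cost e else 0ℚ)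

  -- Arc *indices*: an arc is
  -- (e , i , d): the i-th bidirected pair of edge e, direction d
  -- (true: tl e → hd e, false: hd e → tl e).  Only arcs whose edge lies in F
  -- belong to D (see InD).
  module Digraph (k : ℕ) (F : EdgeSet m) where
    mult : Fin m → ℕ
    mult e = if safe e then suc k else 1

    Arc : Set
    Arc = Σ[ e ∈ Fin m ] (Fin (mult e) × Bool)

    edgeOf : Arc → Fin m
    edgeOf = proj₁

    tail head : Arc → Fin n
    tail (e , _ , true)  = tl e
    tail (e , _ , false) = hd e
    head (e , _ , true)  = hd e
    head (e , _ , false) = tl e

    arcCost : Arc → ℚ
    arcCost a = cost (edgeOf a)

    InD : Arc → Set
    InD a = F (edgeOf a) ≡ true

    allArcs : List Arc
    allArcs = Data.List.concatMap
      (λ e → Data.List.concatMap (λ i → (e , i , true) ∷ (e , i , false) ∷ [])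
                                 (allFin (mult e)))
      (allFin m)

    ArcSet : Set
    ArcSet = Arc → Bool

    costA : ArcSet → ℚ
    costA T = sumℚ allArcs (λ a → if T a then arcCost a else 0ℚ)

    data DReach (T : ArcSet) : Fin n → Fin n → Set where
      here : ∀ v → DReach T v v
      step : ∀ {v} (a : Arc) → T a ≡ true → DReach T (head a) v → DReach T (tail a) v

    data UWalk (T : ArcSet) : Fin n → Fin n → Set where
      nil  : ∀ v → UWalk T v v
      fwd  : ∀ {v} (a : Arc) → T a ≡ true → UWalk T (head a) v → UWalk T (tail a) v
      bwd  : ∀ {v} (a : Arc) → T a ≡ true → UWalk T (tail a) v → UWalk T (head a) v

    walkArcs : ∀ {T u v} → UWalk T u v → List Arc
    walkArcs (nil _)     = []
    walkArcs (fwd a _ w) = a ∷ walkArcs w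
    walkArcs (bwd a _ w) = a ∷ walkArcs w

    walkStarts : ∀ {T u v} → UWalk T u v → List (Fin n)
    walkStarts (nil _)         = []
    walkStarts (fwd {v} a _ w) = tail a ∷ walkStarts w
    walkStarts (bwd {v} a _ w) = head a ∷ walkStarts w

    record Cycle (T : ArcSet) : Set where
      field
        v        : Fin n
        walk     : UWalk T v v
        nonempty : ¬ (walkArcs walk ≡ [])
        arcsDist : Unique (walkArcs walk)
        vertDist : Unique (walkStarts walk)

    IsArborescence : Fin n → ArcSet → Set
    IsArborescence r T =
      (∀ a → T a ≡ true → InD a) ×
      ¬ Cycle T ×
      (∀ v → DReach T r v)

    -- r-rooted j-arborescence: T partitioned into j arc-disjoint
    -- r-rooted arborescences (part a = index of the class of arc a ∈ T)
    IsJArborescence : ℕ → Fin n → ArcSet → Set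
    IsJArborescence j r T =
      Σ[ part ∈ (Arc → Fin j) ]
        (∀ i → IsArborescence r (λ a → T a ∧ ⌊ part a ≟F i ⌋))

natℚ : ℕ → ℚ
natℚ k = + k / 1

-- Feasibility makes D rooted (k+1)-arc-connected: a vertex set X not containing r is crossed either
-- by a safe edge of F, whose k+1 arc pairs give k+1 arcs entering X, or by at least k+1 unsafe edges,
-- since deleting at most k unsafe edges must not separate X from r. By Edmonds' branching theorem, D
-- then has k+1 arc-disjoint spanning r-arborescences. They are built one at a time following Lovász:
-- an arborescence grows arc by arc, never entering a tight set (one whose unused entering arcs number
-- at most k), so the unused arcs still enter every such X at least k times; submodularity of the
-- in-degree makes tight sets closed under intersection, which is what locates an admissible arc.
-- An arborescence contains at most one of the copies of each edge (copies in the same direction share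
-- their head, opposite ones would form a cycle), so each of them costs at most c(F).

module Submission where

open import Level using (0ℓ)
open import Algebra.Bundles using (CommutativeMonoid)
open import Data.Bool using (Bool; true; false; _∧_; _∨_; not; _xor_; if_then_else_)
open import Data.Bool.Properties
  using (∧-conicalˡ; ∧-conicalʳ; ∧-identityʳ; ∧-zeroʳ; ¬-not) renaming (_≟_ to _≟ᴮ_)
open import Data.Empty using (⊥-elim)
open import Data.Fin using (Fin; zero; suc)
open import Data.Fin.Properties using (any?; _≟_)
open import Data.Fin.Subset.Properties using (anySubset?)
import Data.Integer as ℤ
import Data.Integer.Properties as ℤ
open import Data.List using (List; []; _∷_; _++_; concatMap; foldr; length; allFin)
open import Data.List.Membership.Propositional using (_∈_; _∉_; find)
open import Data.List.Membership.Propositional.Properties using (∈-allFin; ∈-concatMap⁻)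
open import Data.List.Properties using (length-tabulate)
open import Data.List.Relation.Unary.All using (All; []; _∷_)
import Data.List.Relation.Unary.All as All
open import Data.List.Relation.Unary.All.Properties using (All¬⇒¬Any)
open import Data.List.Relation.Unary.AllPairs using ([]; _∷_)
open import Data.List.Relation.Unary.Any using (here; there)
open import Data.List.Relation.Unary.Unique.Propositional using (Unique)
open import Data.List.Relation.Unary.Unique.Propositional.Properties using (allFin⁺)
import Data.List.Relation.Unary.Unique.Propositional.Properties as Unique
open import Data.Maybe using (Maybe; just; nothing)
open import Data.Maybe.Properties using (just-injective) renaming (≡-dec to ≡-decᴹ)
open import Data.Nat as ℕ using (ℕ; zero; suc; _+_; _≤_; _<_; _≤?_; z≤n; s≤s)
import Data.Nat.Properties as ℕ
open import Data.Nat.Coprimality using (1-coprimeTo)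
import Data.Nat.Coprimality as Coprime
open import Data.Product using (Σ-syntax; ∃; _×_; _,_; proj₁; proj₂)
open import Data.Product.Properties using () renaming (≡-dec to ≡-decˣ)
open import Data.Rational as ℚ using (ℚ; 0ℚ; 1ℚ; _*_) renaming (_≤_ to _≤ℚ_)
import Data.Rational.Properties as ℚ
open import Data.Sum using (_⊎_; inj₁; inj₂; [_,_])
open import Data.Vec using (lookup; tabulate)
open import Data.Vec.Functional using (updateAt)
open import Data.Vec.Functional.Properties using (updateAt-updates; updateAt-minimal)
open import Data.Vec.Properties using (lookup∘tabulate)
open import Function using (id; const; case_of_)
open import Relation.Binary.Core using (Rel)
open import Relation.Binary.Definitions using (DecidableEquality; Reflexive; Monotonic₂)
open import Relation.Binary.PropositionalEquality
  using (_≡_; _≢_; _≗_; refl; sym; trans; cong; cong₂; subst; subst₂; ≢-sym; module ≡-Reasoning)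
open import Relation.Nullary using (¬_; Dec; yes; no; does; _×-dec_; _⊎-dec_)
open import Relation.Nullary.Decidable using (⌊_⌋; ⌊⌋-map′; dec-true; dec-false; map′)

open import Defs

𝟙 : Bool → ℕ
𝟙 true  = 1
𝟙 false = 0

does⇒ : {P : Set} (P? : Dec P) → does P? ≡ true → P
does⇒ (yes p) _ = p

not-true⇒false : ∀ {x} → not x ≡ true → x ≡ false
not-true⇒false {false} _ = refl

not-antitone : ∀ {x y} → (x ≡ true → y ≡ true) → not y ≡ true → not x ≡ true
not-antitone {false} _   _  = refl
not-antitone {true}  x⇒y ¬y with () ← subst (λ z → not z ≡ true) (x⇒y refl) ¬y

_∖_ : {A : Set} → (A → Bool) → (A → Bool) → A → Bool
(B ∖ T) a = B a ∧ not (T a)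

_⊆_ : {A : Set} → (A → Bool) → (A → Bool) → Set
P ⊆ Q = ∀ a → P a ≡ true → Q a ≡ true

module Summation (M : CommutativeMonoid 0ℓ 0ℓ) where
  open CommutativeMonoid M
    using (_≈_; ∙-cong; ∙-congˡ; assoc; identityˡ; identityʳ; commutativeSemigroup)
    renaming (Carrier to C; _∙_ to _+ᶜ_; ε to 0ᶜ; refl to ≈-refl; sym to ≈-sym; trans to ≈-trans)
  open import Algebra.Properties.CommutativeSemigroup commutativeSemigroup using (interchange)

  sum : {A : Set} → List A → (A → C) → C
  sum xs f = foldr (λ x acc → f x +ᶜ acc) 0ᶜ xs

  module _ {A : Set} where
    sum-cong : (xs : List A) {f g : A → C} → (∀ x → f x ≈ g x) → sum xs f ≈ sum xs g
    sum-cong []       f≈g = ≈-refl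
    sum-cong (x ∷ xs) f≈g = ∙-cong (f≈g x) (sum-cong xs f≈g)

    sum-++ : (xs ys : List A) (f : A → C) → sum (xs ++ ys) f ≈ sum xs f +ᶜ sum ys f
    sum-++ []       ys f = ≈-sym (identityˡ _)
    sum-++ (x ∷ xs) ys f = ≈-trans (∙-congˡ (sum-++ xs ys f)) (≈-sym (assoc _ _ _))

    sum-+ : (xs : List A) (f g : A → C) → sum xs (λ x → f x +ᶜ g x) ≈ sum xs f +ᶜ sum xs g
    sum-+ []       f g = ≈-sym (identityˡ _)
    sum-+ (x ∷ xs) f g = ≈-trans (∙-congˡ (sum-+ xs f g)) (interchange _ _ _ _)

    sum-zero : {xs : List A} {f : A → C} → All (λ x → f x ≈ 0ᶜ) xs → sum xs f ≈ 0ᶜ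
    sum-zero []           = ≈-refl
    sum-zero (fx≈0 ∷ f≈0) = ≈-trans (∙-cong fx≈0 (sum-zero f≈0)) (identityˡ _)

    sum-unique : {xs : List A} {f : A → C} {x₀ : A} → Unique xs → x₀ ∈ xs →
                 (∀ x → x ≢ x₀ → f x ≈ 0ᶜ) → sum xs f ≈ f x₀
    sum-unique (x∉xs ∷ _) (here refl) f≈0 =
      ≈-trans (∙-congˡ (sum-zero (All.map (λ x≢y → f≈0 _ (≢-sym x≢y)) x∉xs))) (identityʳ _)
    sum-unique {x ∷ _} (x∉xs ∷ u) (there x₀∈xs) f≈0 =
      ≈-trans (∙-cong (f≈0 x (All.lookup x∉xs x₀∈xs)) (sum-unique u x₀∈xs f≈0)) (identityˡ _)

  sum-concatMap : {A B : Set} (g : A → List B) (xs : List A) (f : B → C) →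
                  sum (concatMap g xs) f ≈ sum xs (λ x → sum (g x) f)
  sum-concatMap g []       f = ≈-refl
  sum-concatMap g (x ∷ xs) f = ≈-trans (sum-++ (g x) _ f) (∙-congˡ (sum-concatMap g xs f))

  module _ {_≤_ : Rel C 0ℓ} (≤-refl : Reflexive _≤_) (+-mono-≤ : Monotonic₂ _≤_ _≤_ _≤_ _+ᶜ_) where
    sum-mono : {A : Set} (xs : List A) {f g : A → C} → (∀ x → f x ≤ g x) → sum xs f ≤ sum xs g
    sum-mono []       f≤g = ≤-refl
    sum-mono (x ∷ xs) f≤g = +-mono-≤ (f≤g x) (sum-mono xs f≤g)

module ℕΣ = Summation ℕ.+-0-commutativeMonoid

sumℕ-mono : {A : Set} (xs : List A) {f g : A → ℕ} → (∀ x → f x ≤ g x) →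
            ℕΣ.sum xs f ≤ ℕΣ.sum xs g
sumℕ-mono = ℕΣ.sum-mono {_≤_ = _≤_} ℕ.≤-refl ℕ.+-mono-≤

count : {A : Set} → List A → (A → Bool) → ℕ
count xs p = ℕΣ.sum xs (λ x → 𝟙 (p x))

module _ {A : Set} where
  ≤-sumℕ : {xs : List A} (f : A → ℕ) {x : A} → x ∈ xs → f x ≤ ℕΣ.sum xs f
  ≤-sumℕ f (here refl) = ℕ.m≤m+n _ _
  ≤-sumℕ f (there x∈xs) = ℕ.≤-trans (≤-sumℕ f x∈xs) (ℕ.m≤n+m _ _)

  sumℕ-const : (xs : List A) (c : ℕ) → ℕΣ.sum xs (λ _ → c) ≡ length xs ℕ.* c
  sumℕ-const []       c = refl
  sumℕ-const (x ∷ xs) c = cong (c +_) (sumℕ-const xs c)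

  𝟙-mono : {b c : Bool} → (b ≡ true → c ≡ true) → 𝟙 b ≤ 𝟙 c
  𝟙-mono {false} b⇒c = z≤n
  𝟙-mono {true}  b⇒c rewrite b⇒c refl = ℕ.≤-refl

  count-mono : (xs : List A) {p q : A → Bool} → p ⊆ q → count xs p ≤ count xs q
  count-mono xs p⊆q = sumℕ-mono xs (λ x → 𝟙-mono (p⊆q x))

  count-cong : (xs : List A) {p q : A → Bool} → p ≗ q → count xs p ≡ count xs q
  count-cong xs p≗q = ℕΣ.sum-cong xs (λ x → cong 𝟙 (p≗q x))

  count-≥1 : {xs : List A} (p : A → Bool) {x : A} → x ∈ xs → p x ≡ true → 1 ≤ count xs p
  count-≥1 p x∈xs px = ℕ.≤-trans (𝟙-mono {true} λ _ → px) (≤-sumℕ (λ x → 𝟙 (p x)) x∈xs)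

  count-split : (xs : List A) {p q s : A → Bool} → (∀ x → p x ≡ true → q x ≡ true ⊎ s x ≡ true) →
                count xs p ≤ count xs q + count xs s
  count-split xs {p} {q} {s} p⊆q∪s =
    ℕ.≤-trans (sumℕ-mono xs 𝟙-split) (ℕ.≤-reflexive (ℕΣ.sum-+ xs _ _))
    where
    𝟙-split : ∀ x → 𝟙 (p x) ≤ 𝟙 (q x) + 𝟙 (s x)
    𝟙-split x with p x | p⊆q∪s x
    ... | false | _ = z≤n
    ... | true  | p⇒ with p⇒ refl
    ...   | inj₁ qx rewrite qx = s≤s z≤n
    ...   | inj₂ sx rewrite sx = ℕ.m≤n+m 1 (𝟙 (q x))

  count-strict : (xs : List A) {p q : A → Bool} → p ⊆ q →
                 {x : A} → x ∈ xs → p x ≡ false → q x ≡ true → count xs p < count xs q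
  count-strict (_ ∷ xs) p⊆q (here refl) px qx rewrite px | qx = s≤s (count-mono xs p⊆q)
  count-strict (y ∷ xs) p⊆q (there x∈xs) px qx =
    ℕ.+-mono-≤-< (𝟙-mono (p⊆q y)) (count-strict xs p⊆q x∈xs px qx)

  count-witness : (xs : List A) (p q : A → Bool) → count xs p < count xs q →
                  ∃ λ x → q x ≡ true × p x ≡ false
  count-witness (x ∷ xs) p q p<q with q x in qx | p x in px
  ... | true  | false = x , qx , px
  ... | true  | true  = count-witness xs p q (ℕ.+-cancelˡ-< 1 _ _ p<q)
  ... | false | false = count-witness xs p q p<q
  ... | false | true  = count-witness xs p q (ℕ.<-trans (ℕ.n<1+n _) p<q)

  count-pos : (xs : List A) (p : A → Bool) → 1 ≤ count xs p → ∃ λ x → p x ≡ true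
  count-pos (x ∷ xs) p 1≤ with p x in px
  ... | true  = x , px
  ... | false = count-pos xs p 1≤

  count-≡-≤1 : (_≟_ : DecidableEquality A) {xs : List A} → Unique xs →
                   ∀ a → count xs (λ x → does (x ≟ a)) ≤ 1
  count-≡-≤1 _≟_ [] a = z≤n
  count-≡-≤1 _≟_ {x ∷ xs} (x∉xs ∷ u) a with x ≟ a
  ... | yes refl =
    s≤s (ℕ.≤-reflexive (ℕΣ.sum-zero (All.map (λ x≢y → cong 𝟙 (dec-false (_ ≟ x) (≢-sym x≢y))) x∉xs)))
  ... | no _     = count-≡-≤1 _≟_ u a

VertexSet : ℕ → Set
VertexSet n = Fin n → Bool

_∩_ _∪_ : {n : ℕ} → VertexSet n → VertexSet n → VertexSet n
(X ∩ Y) v = X v ∧ Y v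
(X ∪ Y) v = X v ∨ Y v

anyVertexSet? : {n : ℕ} {P : VertexSet n → Set} → (∀ X → Dec (P X)) →
                (∀ {X Y} → X ≗ Y → P X → P Y) → Dec (∃ P)
anyVertexSet? P? resp-P = map′ (λ (s , p) → lookup s , p)
  (λ (X , p) → tabulate X , resp-P (λ v → sym (lookup∘tabulate X v)) p)
  (anySubset? (λ s → P? (lookup s)))

size : {n : ℕ} → VertexSet n → ℕ
size {n} X = count (allFin n) X

module _ {A B : Set} where
  concatMap-unique : {f : A → List B} {xs : List A} → Unique xs → (∀ x → Unique (f x)) →
                     (∀ {x y z} → z ∈ f x → z ∈ f y → x ≡ y) → Unique (concatMap f xs)
  concatMap-unique [] _ _ = []
  concatMap-unique {f} {x ∷ xs} (x∉xs ∷ u) f-unique f-disjoint =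
    Unique.++⁺ (f-unique x) (concatMap-unique u f-unique f-disjoint) disjoint
    where
    disjoint : ∀ {z} → ¬ (z ∈ f x × z ∈ concatMap f xs)
    disjoint (z∈fx , z∈rest) with y , y∈xs , z∈fy ← find (∈-concatMap⁻ f z∈rest) =
      All.lookup x∉xs y∈xs (f-disjoint z∈fx z∈fy)

module Branching {n : ℕ} {Arc : Set} (_≟ᴬ_ : DecidableEquality Arc) (tail head : Arc → Fin n)
                 (arcs : List Arc) (arcs-unique : Unique arcs) (r : Fin n) where

  enters : VertexSet n → Arc → Bool
  enters X a = X (head a) ∧ not (X (tail a))

  indegree : (Arc → Bool) → VertexSet n → ℕ
  indegree B X = count arcs (λ a → B a ∧ enters X a)

  CutsAtLeast : ℕ → (Arc → Bool) → Set
  CutsAtLeast k B = ∀ X → X r ≡ false → (∃ λ v → X v ≡ true) → k ≤ indegree B X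

  indegree-resp : ∀ B {X Y} → X ≗ Y → indegree B X ≡ indegree B Y
  indegree-resp B X≗Y =
    count-cong arcs (λ a → cong₂ (λ h t → B a ∧ (h ∧ not t)) (X≗Y (head a)) (X≗Y (tail a)))

  enters-submodular : ∀ b xh xt yh yt →
    𝟙 (b ∧ ((xh ∧ yh) ∧ not (xt ∧ yt))) + 𝟙 (b ∧ ((xh ∨ yh) ∧ not (xt ∨ yt)))
      ≤ 𝟙 (b ∧ (xh ∧ not xt)) + 𝟙 (b ∧ (yh ∧ not yt))
  enters-submodular false _     _     _     _     = z≤n
  enters-submodular true  true  true  true  true  = z≤n
  enters-submodular true  true  true  true  false = s≤s z≤n
  enters-submodular true  true  true  false true  = z≤n
  enters-submodular true  true  true  false false = z≤n
  enters-submodular true  true  false true  true  = s≤s z≤n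
  enters-submodular true  true  false true  false = s≤s (s≤s z≤n)
  enters-submodular true  true  false false true  = z≤n
  enters-submodular true  true  false false false = s≤s z≤n
  enters-submodular true  false true  true  true  = z≤n
  enters-submodular true  false true  true  false = z≤n
  enters-submodular true  false true  false true  = z≤n
  enters-submodular true  false true  false false = z≤n
  enters-submodular true  false false true  true  = z≤n
  enters-submodular true  false false true  false = s≤s z≤n
  enters-submodular true  false false false true  = z≤n
  enters-submodular true  false false false false = z≤n

  indegree-submodular : ∀ B X Y → indegree B (X ∩ Y) + indegree B (X ∪ Y) ≤ indegree B X + indegree B Y
  indegree-submodular B X Y = begin
    indegree B (X ∩ Y) + indegree B (X ∪ Y)  ≡⟨ ℕΣ.sum-+ arcs _ _ ⟨
    ℕΣ.sum arcs _                            ≤⟨ sumℕ-mono arcs (λ a →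
                                                  enters-submodular (B a) (X (head a)) (X (tail a)) (Y (head a)) (Y (tail a))) ⟩
    ℕΣ.sum arcs _                            ≡⟨ ℕΣ.sum-+ arcs _ _ ⟩
    indegree B X + indegree B Y              ∎
    where open ℕ.≤-Reasoning

  entering-complement : ∀ (S : VertexSet n) a → enters (λ v → not (S v)) a ≡ true →
                        S (tail a) ≡ true × S (head a) ≡ false
  entering-complement S a e with S (head a) | S (tail a)
  entering-complement S a () | true  | _
  entering-complement S a () | false | false
  ... | false | true = refl , refl

  parentArcs : (Fin n → Maybe Arc) → Arc → Bool
  parentArcs parent a = does (≡-decᴹ _≟ᴬ_ (parent (head a)) (just a))

  parentArcs-sound : ∀ parent b → parentArcs parent b ≡ true → parent (head b) ≡ just b
  parentArcs-sound parent b = does⇒ (≡-decᴹ _≟ᴬ_ (parent (head b)) (just b))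

  parentArcs-complete : ∀ parent b → parent (head b) ≡ just b → parentArcs parent b ≡ true
  parentArcs-complete parent b = dec-true (≡-decᴹ _≟ᴬ_ (parent (head b)) (just b))

  record SpanningArborescence (B T : Arc → Bool) : Set where
    field
      parent       : Fin n → Maybe Arc
      depth        : Fin n → ℕ
      parent-valid : ∀ v a → parent v ≡ just a → B a ≡ true × head a ≡ v × depth (tail a) < depth v
      parent-total : ∀ v → v ≢ r → ∃ λ a → parent v ≡ just a
      T-parents    : ∀ a → T a ≡ parentArcs parent a

  arborescence-resp : ∀ {B T T′} → T′ ≗ T → SpanningArborescence B T → SpanningArborescence B T′
  arborescence-resp T′≗T A = record
    { parent = parent ; depth = depth ; parent-valid = parent-valid ; parent-total = parent-total
    ; T-parents = λ a → trans (T′≗T a) (T-parents a) }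
    where open SpanningArborescence A

  arborescence-mono : ∀ {B B′ T} → B ⊆ B′ → SpanningArborescence B T → SpanningArborescence B′ T
  arborescence-mono B⊆B′ A = record
    { parent = parent ; depth = depth ; parent-total = parent-total ; T-parents = T-parents
    ; parent-valid = λ v a pa → let Ba , ha , d< = parent-valid v a pa in B⊆B′ a Ba , ha , d< }
    where open SpanningArborescence A

  module Extraction (B : Arc → Bool) (k : ℕ) (B-cuts : CutsAtLeast (suc k) B) where

    record PartialArborescence : Set where
      field
        reached        : VertexSet n
        parent         : Fin n → Maybe Arc
        depth          : Fin n → ℕ
        root-reached   : reached r ≡ true
        parent-valid   : ∀ v a → parent v ≡ just a → B a ≡ true × head a ≡ v × depth (tail a) < depth v
        parent-reached : ∀ v a → parent v ≡ just a → reached v ≡ true × reached (tail a) ≡ true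
        parent-total   : ∀ v → reached v ≡ true → v ≢ r → ∃ λ a → parent v ≡ just a
        residual-cuts  : CutsAtLeast k (B ∖ parentArcs parent)

      unreached : VertexSet n
      unreached v = not (reached v)

    module _ (P : PartialArborescence) where
      open PartialArborescence P

      T R : Arc → Bool
      T = parentArcs parent
      R = B ∖ T

      T-parent : ∀ b → T b ≡ true → parent (head b) ≡ just b
      T-parent = parentArcs-sound parent

      R-outside : ∀ b → reached (head b) ≡ false → R b ≡ B b
      R-outside b hb with T b in Tb
      ... | false = ∧-identityʳ (B b)
      ... | true with () ← trans (sym hb) (proj₁ (parent-reached (head b) b (T-parent b Tb)))

      indegree-outside : ∀ X → (∀ v → X v ≡ true → reached v ≡ false) → indegree B X ≤ indegree R X
      indegree-outside X X⊆unreached = count-mono arcs B⇒R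
        where
        B⇒R : ∀ b → B b ∧ enters X b ≡ true → R b ∧ enters X b ≡ true
        B⇒R b e rewrite R-outside b (X⊆unreached (head b) (∧-conicalˡ (X (head b)) _ (∧-conicalʳ (B b) _ e))) =
          e

      -- The sets the next arc must not enter: that would leave fewer than k unused arcs entering them.
      Tight : VertexSet n → Set
      Tight Y = Y r ≡ false × (∃ λ u → Y u ≡ true × reached u ≡ false) × indegree R Y ≤ k

      tight? : ∀ Y → Dec (Tight Y)
      tight? Y = (Y r ≟ᴮ false)
        ×-dec any? (λ u → (Y u ≟ᴮ true) ×-dec (reached u ≟ᴮ false))
        ×-dec (indegree R Y ≤? k)

      tight-resp : ∀ {X Y} → X ≗ Y → Tight X → Tight Y
      tight-resp X≗Y (Xr , (u , Xu , u∉) , ρX) =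
        trans (sym (X≗Y r)) Xr , (u , trans (sym (X≗Y u)) Xu , u∉) , subst (_≤ k) (indegree-resp R X≗Y) ρX

      tight-gains-outside : ∀ X → Tight X → indegree R X < indegree R (X ∖ reached)
      tight-gains-outside X (Xr , (u , Xu , u∉) , ρX≤k) = ℕ.≤-trans (s≤s ρX≤k) (ℕ.≤-trans
        (B-cuts (X ∖ reached) (cong (_∧ not (reached r)) Xr) (u , cong₂ (λ x s → x ∧ not s) Xu u∉))
        (indegree-outside (X ∖ reached) (λ v e → not-true⇒false (∧-conicalʳ (X v) _ e))))

      tight-entry : ∀ X → Tight X → ∃ λ a → R a ≡ true × X (head a) ≡ true × reached (head a) ≡ false ×
                                             X (tail a) ≡ true × reached (tail a) ≡ true
      tight-entry X X-tight
        with a , enters-X∖reached , ¬enters-X ← count-witness arcs _ _ (tight-gains-outside X X-tight)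
        = a , crossing ¬enters-X enters-X∖reached
        where
        crossing : ∀ {ra xh sh xt st} → ra ∧ (xh ∧ not xt) ≡ false →
                   ra ∧ ((xh ∧ not sh) ∧ not (xt ∧ not st)) ≡ true →
                   ra ≡ true × xh ≡ true × sh ≡ false × xt ≡ true × st ≡ true
        crossing {true} {true} {false} {true} {true} _ _ = refl , refl , refl , refl , refl

      tight-∩ : ∀ {X Y} → Tight X → Tight Y →
                ∀ u → X u ≡ true → Y u ≡ true → reached u ≡ false → Tight (X ∩ Y)
      tight-∩ {X} {Y} (Xr , _ , ρX≤k) (Yr , _ , ρY≤k) u Xu Yu u∉ =
        cong (_∧ Y r) Xr , (u , cong₂ _∧_ Xu Yu , u∉) , ℕ.+-cancelʳ-≤ k _ _ (begin
          indegree R (X ∩ Y) + k                   ≤⟨ ℕ.+-monoʳ-≤ _ k≤ρ[X∪Y] ⟩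
          indegree R (X ∩ Y) + indegree R (X ∪ Y)  ≤⟨ indegree-submodular R X Y ⟩
          indegree R X + indegree R Y              ≤⟨ ℕ.+-mono-≤ ρX≤k ρY≤k ⟩
          k + k                                    ∎)
        where
        open ℕ.≤-Reasoning
        k≤ρ[X∪Y] : k ≤ indegree R (X ∪ Y)
        k≤ρ[X∪Y] = residual-cuts (X ∪ Y) (cong₂ _∨_ Xr Yr) (u , cong (_∨ Y u) Xu)

      record Admissible (a : Arc) : Set where
        constructor mkAdmissible
        field
          residual       : R a ≡ true
          tail-reached   : reached (tail a) ≡ true
          head-unreached : reached (head a) ≡ false
          avoids-tight   : ∀ Y → Tight Y → enters Y a ≡ false

      tight-entered? : ∀ a → Dec (∃ λ Y → Tight Y × enters Y a ≡ true)
      tight-entered? a = anyVertexSet? (λ Y → tight? Y ×-dec (enters Y a ≟ᴮ true))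
        (λ X≗Y (X-tight , Xa) → tight-resp X≗Y X-tight ,
           trans (cong₂ (λ h t → h ∧ not t) (sym (X≗Y (head a))) (sym (X≗Y (tail a)))) Xa)

      -- If the entry arc a of X enters a tight Y, then X ∩ Y is tight and misses the tail of a.
      find-admissible-in : (fuel : ℕ) → ∀ X → size X ≤ fuel → Tight X → ∃ Admissible
      find-admissible-in zero X size≤0 (_ , (u , Xu , _) , _)
        with () ← ℕ.≤-trans (count-≥1 X (∈-allFin u) Xu) size≤0
      find-admissible-in (suc fuel) X size≤ X-tight
        with a , Ra , Xh , h∉ , Xt , t∈ ← tight-entry X X-tight
        with tight-entered? a
      ... | no ¬entered = a , mkAdmissible Ra t∈ h∉ λ Y Y-tight → ¬-not λ Ya → ¬entered (Y , Y-tight , Ya)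
      ... | yes (Y , Y-tight , Ya) =
        find-admissible-in fuel (X ∩ Y) (ℕ.≤-pred (ℕ.≤-trans size[X∩Y]<size[X] size≤))
          (tight-∩ X-tight Y-tight (head a) Xh (∧-conicalˡ (Y (head a)) _ Ya) h∉)
        where
        size[X∩Y]<size[X] : size (X ∩ Y) < size X
        size[X∩Y]<size[X] = count-strict (allFin n) (λ v → ∧-conicalˡ (X v) (Y v)) (∈-allFin (tail a))
          (cong₂ _∧_ Xt (not-true⇒false (∧-conicalʳ (Y (head a)) _ Ya))) Xt

      find-admissible : (∃ λ u → reached u ≡ false) → ∃ Admissible
      find-admissible (u , u∉) with anyVertexSet? tight? tight-resp
      ... | yes (X , X-tight) = find-admissible-in (size X) X ℕ.≤-refl X-tight
      ... | no ¬tight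
        with a , e ← count-pos arcs (λ b → R b ∧ enters unreached b)
                       (ℕ.≤-trans (s≤s z≤n) (ℕ.≤-trans
                         (B-cuts unreached (cong not root-reached) (u , cong not u∉))
                         (indegree-outside unreached (λ v → not-true⇒false))))
        with t∈ , h∉ ← entering-complement reached a (∧-conicalʳ (R a) _ e)
        = a , mkAdmissible (∧-conicalˡ (R a) _ e) t∈ h∉ λ Y Y-tight → ⊥-elim (¬tight (Y , Y-tight))

    module Grow (P : PartialArborescence) (a : Arc) (a-admissible : Admissible P a) where
      open PartialArborescence P
      open Admissible a-admissible renaming (residual to Ra; tail-reached to t∈; head-unreached to h∉)

      v₀ : Fin n
      v₀ = head a

      reached′ : VertexSet n
      reached′ = updateAt reached v₀ (const true)

      parent′ : Fin n → Maybe Arc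
      parent′ = updateAt parent v₀ (const (just a))

      depth′ : Fin n → ℕ
      depth′ = updateAt depth v₀ (const (suc (depth (tail a))))

      reached⇒≢v₀ : ∀ u → reached u ≡ true → u ≢ v₀
      reached⇒≢v₀ u u∈ refl with () ← trans (sym u∈) h∉

      reached-grows : ∀ u → reached u ≡ true → reached′ u ≡ true
      reached-grows u u∈ = trans (updateAt-minimal u v₀ reached (reached⇒≢v₀ u u∈)) u∈

      parent′-v₀ : ∀ b → parent′ v₀ ≡ just b → a ≡ b
      parent′-v₀ b eq = just-injective (trans (sym (updateAt-updates v₀ parent)) eq)

      parent′-old : ∀ v b → v ≢ v₀ → parent′ v ≡ just b → parent v ≡ just b
      parent′-old v b v≢v₀ eq = trans (sym (updateAt-minimal v v₀ parent v≢v₀)) eq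

      parent′-valid : ∀ v b → parent′ v ≡ just b →
                      B b ≡ true × head b ≡ v × depth′ (tail b) < depth′ v
      parent′-valid v b eq with v ≟ v₀
      ... | yes refl with refl ← parent′-v₀ b eq =
        ∧-conicalˡ (B a) _ Ra , refl ,
        subst₂ _<_ (sym (updateAt-minimal (tail a) v₀ depth (reached⇒≢v₀ _ t∈)))
                   (sym (updateAt-updates v₀ depth)) ℕ.≤-refl
      ... | no v≢v₀
        with Bb , refl , d< ← parent-valid v b (parent′-old v b v≢v₀ eq)
        with _ , tb∈ ← parent-reached v b (parent′-old v b v≢v₀ eq) =
        Bb , refl ,
        subst₂ _<_ (sym (updateAt-minimal (tail b) v₀ depth (reached⇒≢v₀ _ tb∈)))
                   (sym (updateAt-minimal v v₀ depth v≢v₀)) d<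

      parent′-reached : ∀ v b → parent′ v ≡ just b → reached′ v ≡ true × reached′ (tail b) ≡ true
      parent′-reached v b eq with v ≟ v₀
      ... | yes refl with refl ← parent′-v₀ b eq = updateAt-updates v₀ reached , reached-grows (tail a) t∈
      ... | no v≢v₀ with v∈ , tb∈ ← parent-reached v b (parent′-old v b v≢v₀ eq) =
        reached-grows v v∈ , reached-grows (tail b) tb∈

      parent′-total : ∀ v → reached′ v ≡ true → v ≢ r → ∃ λ b → parent′ v ≡ just b
      parent′-total v v∈′ v≢r with v ≟ v₀
      ... | yes refl = a , updateAt-updates v₀ parent
      ... | no v≢v₀
        with b , eq ← parent-total v (trans (sym (updateAt-minimal v v₀ reached v≢v₀)) v∈′) v≢r =
        b , trans (updateAt-minimal v v₀ parent v≢v₀) eq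

      T′-new : ∀ b → parentArcs parent′ b ≡ true → T P b ≡ true ⊎ b ≡ a
      T′-new b T′b with head b ≟ v₀
      ... | yes hb≡v₀ =
        inj₂ (sym (parent′-v₀ b (trans (cong parent′ (sym hb≡v₀)) (parentArcs-sound parent′ b T′b))))
      ... | no hb≢v₀ =
        inj₁ (parentArcs-complete parent b (parent′-old (head b) b hb≢v₀ (parentArcs-sound parent′ b T′b)))

      R′ : Arc → Bool
      R′ = B ∖ parentArcs parent′

      R-shrinks-to : ∀ b → R P b ≡ true → R′ b ≡ true ⊎ b ≡ a
      R-shrinks-to b Rb with parentArcs parent′ b in T′b
      ... | false = inj₁ (trans (∧-identityʳ (B b)) (∧-conicalˡ (B b) _ Rb))
      ... | true with T′-new b T′b
      ...   | inj₂ b≡a = inj₂ b≡a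
      ...   | inj₁ Tb with () ← subst (λ z → not z ≡ true) Tb (∧-conicalʳ (B b) _ Rb)

      residual′-cuts : CutsAtLeast k R′
      residual′-cuts Z Zr Z≢∅ with enters Z a in Za
      ... | false = ℕ.≤-trans (residual-cuts Z Zr Z≢∅) (count-mono arcs kept)
        where
        kept : ∀ b → R P b ∧ enters Z b ≡ true → R′ b ∧ enters Z b ≡ true
        kept b e with R-shrinks-to b (∧-conicalˡ (R P b) _ e)
        ... | inj₁ R′b = cong₂ _∧_ R′b (∧-conicalʳ (R P b) _ e)
        ... | inj₂ refl with () ← trans (sym Za) (∧-conicalʳ (R P b) _ e)
      ... | true = ℕ.≤-pred (begin
        suc k                                             ≤⟨ ℕ.≰⇒> Z-not-tight ⟩
        indegree (R P) Z                                  ≤⟨ count-split arcs lost ⟩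
        indegree R′ Z + count arcs (λ b → does (b ≟ᴬ a))  ≤⟨ ℕ.+-monoʳ-≤ _ (count-≡-≤1 _≟ᴬ_ arcs-unique a) ⟩
        indegree R′ Z + 1                                 ≡⟨ ℕ.+-comm _ 1 ⟩
        suc (indegree R′ Z)                               ∎)
        where
        open ℕ.≤-Reasoning
        Z-not-tight : ¬ indegree (R P) Z ≤ k
        Z-not-tight ρ≤k
          with () ← trans (sym Za) (avoids-tight Z (Zr , (v₀ , ∧-conicalˡ (Z v₀) _ Za , h∉) , ρ≤k))
        lost : ∀ b → R P b ∧ enters Z b ≡ true → R′ b ∧ enters Z b ≡ true ⊎ does (b ≟ᴬ a) ≡ true
        lost b e with R-shrinks-to b (∧-conicalˡ (R P b) _ e)
        ... | inj₁ R′b = inj₁ (cong₂ _∧_ R′b (∧-conicalʳ (R P b) _ e))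
        ... | inj₂ b≡a = inj₂ (dec-true (b ≟ᴬ a) b≡a)

      grown : PartialArborescence
      grown = record
        { reached = reached′ ; parent = parent′ ; depth = depth′
        ; root-reached = reached-grows r root-reached
        ; parent-valid = parent′-valid ; parent-reached = parent′-reached
        ; parent-total = parent′-total ; residual-cuts = residual′-cuts }

      grown-progress : size (PartialArborescence.unreached grown) < size unreached
      grown-progress = count-strict (allFin n) (λ u → not-antitone (reached-grows u)) (∈-allFin v₀)
        (cong not (updateAt-updates v₀ reached)) (cong not h∉)

    initial : PartialArborescence
    initial = record
      { reached = λ u → does (u ≟ r) ; parent = const nothing ; depth = const 0
      ; root-reached = dec-true (r ≟ r) refl
      ; parent-valid = λ _ _ ()
      ; parent-reached = λ _ _ ()
      ; parent-total = λ v v∈ v≢r → ⊥-elim (v≢r (does⇒ (v ≟ r) v∈))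
      ; residual-cuts = λ X Xr X≢∅ → ℕ.≤-trans (ℕ.n≤1+n k) (ℕ.≤-trans (B-cuts X Xr X≢∅)
          (ℕ.≤-reflexive (count-cong arcs (λ a → cong (_∧ enters X a) (sym (∧-identityʳ (B a)))))))
      }

    Result : Set
    Result = ∃ λ T → SpanningArborescence B T × CutsAtLeast k (B ∖ T)

    complete : (fuel : ℕ) (P : PartialArborescence) → size (PartialArborescence.unreached P) ≤ fuel → Result
    complete fuel P size≤ with any? (λ u → PartialArborescence.reached P u ≟ᴮ false)
    ... | no all-reached = T P , arborescence , residual-cuts
      where
      open PartialArborescence P
      arborescence : SpanningArborescence B (T P)
      arborescence = record
        { parent = parent ; depth = depth ; parent-valid = parent-valid
        ; parent-total = λ v → parent-total v (¬-not λ v∉ → all-reached (v , v∉))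
        ; T-parents = λ _ → refl }
    ... | yes (u , u∉) with fuel
    ...   | zero with () ← ℕ.≤-trans (count-≥1 _ (∈-allFin u) (cong not u∉)) size≤
    ...   | suc fuel′ with a , a-admissible ← find-admissible P (u , u∉) =
      complete fuel′ (Grow.grown P a a-admissible)
        (ℕ.≤-pred (ℕ.≤-trans (Grow.grown-progress P a a-admissible) size≤))

    extract : Result
    extract = complete _ initial ℕ.≤-refl

module ℚΣ = Summation ℚ.+-0-commutativeMonoid

sumℚ-mono : {A : Set} (xs : List A) {f g : A → ℚ} → (∀ x → f x ≤ℚ g x) →
            sumℚ xs f ≤ℚ sumℚ xs g
sumℚ-mono = ℚΣ.sum-mono {_≤_ = _≤ℚ_} ℚ.≤-refl ℚ.+-mono-≤

natℚ-suc : ∀ j → natℚ (suc j) ≡ 1ℚ ℚ.+ natℚ j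
natℚ-suc j = begin
  natℚ (suc j)                                         ≡⟨ cong (λ z → (ℤ.+ 1 ℤ.+ z) ℚ./ 1) (ℤ.*-identityʳ (ℤ.+ j)) ⟨
  (ℤ.+ 1 ℤ.* ℤ.+ 1 ℤ.+ ℤ.+ j ℤ.* ℤ.+ 1) ℚ./ (1 ℕ.* 1)  ≡⟨⟩
  1ℚ ℚ.+ j/1                                           ≡⟨ cong (1ℚ ℚ.+_) (ℚ.↥p/↧p≡p j/1) ⟨
  1ℚ ℚ.+ natℚ j                                        ∎
  where
  open ≡-Reasoning
  j/1 : ℚ
  j/1 = ℚ.mkℚ (ℤ.+ j) 0 (Coprime.sym (1-coprimeTo j))

natℚ-suc-* : ∀ j c → natℚ (suc j) ℚ.* c ≡ c ℚ.+ natℚ j ℚ.* c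
natℚ-suc-* j c = begin
  natℚ (suc j) ℚ.* c         ≡⟨ cong (ℚ._* c) (natℚ-suc j) ⟩
  (1ℚ ℚ.+ natℚ j) ℚ.* c      ≡⟨ ℚ.*-distribʳ-+ c 1ℚ (natℚ j) ⟩
  1ℚ ℚ.* c ℚ.+ natℚ j ℚ.* c  ≡⟨ cong (ℚ._+ natℚ j ℚ.* c) (ℚ.*-identityˡ c) ⟩
  c ℚ.+ natℚ j ℚ.* c         ∎
  where open ≡-Reasoning

module Application {n m : ℕ} (I : Instance n m) (k : ℕ) (F : EdgeSet m) where
  open Instance I
  open Digraph I k F

  _≟ᴬ_ : DecidableEquality Arc
  _≟ᴬ_ = ≡-decˣ _≟_ (≡-decˣ _≟_ _≟ᴮ_)

  arcPair : (e : Fin m) → Fin (mult e) → List Arc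
  arcPair e i = (e , i , true) ∷ (e , i , false) ∷ []

  arcsOf : Fin m → List Arc
  arcsOf e = concatMap (arcPair e) (allFin (mult e))

  ∈-arcsOf⇒edge : ∀ {e a} → a ∈ arcsOf e → edgeOf a ≡ e
  ∈-arcsOf⇒edge {e} a∈ with _ , _ , a∈pair ← find (∈-concatMap⁻ (arcPair e) {allFin (mult e)} a∈) =
    edge-of-pair a∈pair
    where
    edge-of-pair : ∀ {i a} → a ∈ arcPair e i → edgeOf a ≡ e
    edge-of-pair (here refl)         = refl
    edge-of-pair (there (here refl)) = refl

  allArcs-unique : Unique allArcs
  allArcs-unique = concatMap-unique (allFin⁺ m) arcsOf-unique
    (λ a∈x a∈y → trans (sym (∈-arcsOf⇒edge a∈x)) (∈-arcsOf⇒edge a∈y))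
    where
    same-pair : ∀ {e i j a} → a ∈ arcPair e i → a ∈ arcPair e j → i ≡ j
    same-pair (here refl)         (here refl)         = refl
    same-pair (there (here refl)) (there (here refl)) = refl
    same-pair (here refl)         (there (here ()))
    same-pair (there (here refl)) (here ())
    arcsOf-unique : ∀ e → Unique (arcsOf e)
    arcsOf-unique e =
      concatMap-unique (allFin⁺ (mult e)) (λ i → ((λ ()) All.∷ All.[]) ∷ All.[] ∷ []) same-pair

  module Forest {T : ArcSet} (depth : Fin n → ℕ)
                (head-injective : ∀ b c → T b ≡ true → T c ≡ true → head b ≡ head c → b ≡ c)
                (depth-increases : ∀ b → T b ≡ true → depth (tail b) < depth (head b)) where

    -- Leaving u by any arc other than c, the only arc of T entering u, means moving forward along T.
    forward-walk : ∀ {u y} (w : UWalk T u y) (c : Arc) → T c ≡ true → head c ≡ u →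
                   c ∉ walkArcs w → Unique (walkArcs w) →
                   depth u ≤ depth y × ∃ λ b → T b ≡ true × head b ≡ y × (b ≡ c ⊎ b ∈ walkArcs w)
    forward-walk (nil _) c Tc refl _ _ = ℕ.≤-refl , c , Tc , refl , inj₁ refl
    forward-walk (fwd a Ta w) c Tc hc c∉ (a∉w ∷ u)
      with u≤y , b , Tb , hb , b∈ ← forward-walk w a Ta refl (All¬⇒¬Any a∉w) u =
      ℕ.≤-trans (ℕ.<⇒≤ (depth-increases a Ta)) u≤y , b , Tb , hb , inj₂ ([ here , there ] b∈)
    forward-walk (bwd a Ta w) c Tc hc c∉ _ = ⊥-elim (c∉ (here (head-injective c a Tc Ta hc)))

    descends-or-enters : ∀ {u y} (w : UWalk T u y) → Unique (walkArcs w) →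
                         depth y ≤ depth u ⊎ ∃ λ b → T b ≡ true × head b ≡ y × b ∈ walkArcs w
    descends-or-enters (nil _) _ = inj₁ ℕ.≤-refl
    descends-or-enters (bwd a Ta w) (_ ∷ u) with descends-or-enters w u
    ... | inj₁ y≤t = inj₁ (ℕ.≤-trans y≤t (ℕ.<⇒≤ (depth-increases a Ta)))
    ... | inj₂ (b , Tb , hb , b∈w) = inj₂ (b , Tb , hb , there b∈w)
    descends-or-enters (fwd a Ta w) (a∉w ∷ u)
      with _ , b , Tb , hb , b∈ ← forward-walk w a Ta refl (All¬⇒¬Any a∉w) u =
      inj₂ (b , Tb , hb , [ here , there ] b∈)

    no-closed-walk : ∀ {u} (w : UWalk T u u) → walkArcs w ≢ [] → ¬ Unique (walkArcs w)
    no-closed-walk (nil _) w≢[] _ = w≢[] refl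
    no-closed-walk (fwd a Ta w) _ (a∉w ∷ u)
      with h≤t , _ ← forward-walk w a Ta refl (All¬⇒¬Any a∉w) u = ℕ.<⇒≱ (depth-increases a Ta) h≤t
    no-closed-walk (bwd a Ta w) _ (a∉w ∷ u) with descends-or-enters w u
    ... | inj₁ h≤t = ℕ.<⇒≱ (depth-increases a Ta) h≤t
    ... | inj₂ (b , Tb , hb , b∈w) =
      All¬⇒¬Any a∉w (subst (_∈ walkArcs w) (head-injective b a Tb Ta hb) b∈w)

    acyclic : ¬ Cycle T
    acyclic C = no-closed-walk (Cycle.walk C) (Cycle.nonempty C) (Cycle.arcsDist C)

  DReach-snoc : ∀ {T x y} → DReach T x y → ∀ a → T a ≡ true → tail a ≡ y → DReach T x (head a)
  DReach-snoc (here _)     a Ta refl = step a Ta (here (head a))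
  DReach-snoc (step b Tb w) a Ta ty  = step b Tb (DReach-snoc w a Ta ty)

  UReach-constant : ∀ (X : VertexSet n) {H u v} → (∀ e → H e ≡ true → X (tl e) ≡ X (hd e)) →
                    UReach I H u v → X u ≡ X v
  UReach-constant X X-const (here _)     = refl
  UReach-constant X X-const (fwd e He w) = trans (X-const e He) (UReach-constant X X-const w)
  UReach-constant X X-const (bwd e He w) = trans (sym (X-const e He)) (UReach-constant X X-const w)

  countB≡count : ∀ (H : EdgeSet m) → countB H ≡ count (allFin m) H
  countB≡count H = go (allFin m)
    where
    go : ∀ es → foldr (λ e acc → if H e then suc acc else acc) 0 es ≡ count es H
    go []       = refl
    go (e ∷ es) with H e
    ... | true  = cong suc (go es)
    ... | false = go es

  mult-nonZero : ∀ e → ℕ.NonZero (mult e)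
  mult-nonZero e with safe e
  ... | true  = _
  ... | false = _

  inD : ArcSet
  inD a = F (edgeOf a)

  module Rooted (r : Fin n) where
    open Branching _≟ᴬ_ tail head allArcs allArcs-unique r

    module _ {B T : ArcSet} (A : SpanningArborescence B T) where
      open SpanningArborescence A

      T-parent : ∀ b → T b ≡ true → parent (head b) ≡ just b
      T-parent b Tb = parentArcs-sound parent b (trans (sym (T-parents b)) Tb)

      T⊆B : T ⊆ B
      T⊆B b Tb = proj₁ (parent-valid (head b) b (T-parent b Tb))

      T-head-injective : ∀ b c → T b ≡ true → T c ≡ true → head b ≡ head c → b ≡ c
      T-head-injective b c Tb Tc hb≡hc =
        just-injective (trans (sym (T-parent b Tb)) (trans (cong parent hb≡hc) (T-parent c Tc)))

      T-depth-increases : ∀ b → T b ≡ true → depth (tail b) < depth (head b)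
      T-depth-increases b Tb = proj₂ (proj₂ (parent-valid (head b) b (T-parent b Tb)))

      one-arc-per-edge : ∀ e i j b c → T (e , i , b) ≡ true → T (e , j , c) ≡ true → i ≡ j × b ≡ c
      one-arc-per-edge e i j true  true  Ti Tj with refl ← T-head-injective _ _ Ti Tj refl = refl , refl
      one-arc-per-edge e i j false false Ti Tj with refl ← T-head-injective _ _ Ti Tj refl = refl , refl
      one-arc-per-edge e i j true  false Ti Tj = ⊥-elim (ℕ.<-asym (T-depth-increases _ Ti) (T-depth-increases _ Tj))
      one-arc-per-edge e i j false true  Ti Tj = ⊥-elim (ℕ.<-asym (T-depth-increases _ Ti) (T-depth-increases _ Tj))

      reachable : ∀ fuel v → depth v ≤ fuel → DReach T r v
      reachable fuel v depth≤ with v ≟ r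
      ... | yes refl = here r
      ... | no v≢r with a , pa ← parent-total v v≢r with _ , refl , d< ← parent-valid v a pa with fuel
      ...   | zero = ⊥-elim (ℕ.<⇒≱ d< (ℕ.≤-trans depth≤ z≤n))
      ...   | suc fuel′ = DReach-snoc (reachable fuel′ (tail a) (ℕ.≤-pred (ℕ.≤-trans d< depth≤))) a
                          (trans (T-parents a) (parentArcs-complete parent a pa)) refl

      isArborescence : B ⊆ inD → IsArborescence r T
      isArborescence B⊆D = (λ b Tb → B⊆D b (T⊆B b Tb))
                         , Forest.acyclic depth T-head-injective T-depth-increases
                         , (λ v → reachable (depth v) v ℕ.≤-refl)

    crossingEdges : VertexSet n → EdgeSet m
    crossingEdges X e = F e ∧ (X (hd e) xor X (tl e))

    uncrossed : ∀ X e → (F ∖ crossingEdges X) e ≡ true → X (tl e) ≡ X (hd e)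
    uncrossed X e e∈ with F e | X (hd e) | X (tl e)
    uncrossed X e () | false | _     | _
    uncrossed X e () | true  | true  | false
    uncrossed X e () | true  | false | true
    ... | true | true  | true  = refl
    ... | true | false | false = refl

    crossingArcs : VertexSet n → Fin m → ℕ
    crossingArcs X e = mult e ℕ.* 𝟙 (crossingEdges X e)

    indegree-by-edge : ∀ X → indegree inD X ≡ ℕΣ.sum (allFin m) (crossingArcs X)
    indegree-by-edge X = trans (ℕΣ.sum-concatMap arcsOf (allFin m) _) (ℕΣ.sum-cong (allFin m) per-edge)
      where
      pair-entering : ∀ f h t → 𝟙 (f ∧ (h ∧ not t)) + (𝟙 (f ∧ (t ∧ not h)) + 0) ≡ 𝟙 (f ∧ (h xor t))
      pair-entering false _     _     = refl
      pair-entering true  true  true  = refl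
      pair-entering true  true  false = refl
      pair-entering true  false true  = refl
      pair-entering true  false false = refl
      per-edge : ∀ e → ℕΣ.sum (arcsOf e) (λ a → 𝟙 (inD a ∧ enters X a)) ≡ crossingArcs X e
      per-edge e = begin
        ℕΣ.sum (arcsOf e) _                                     ≡⟨ ℕΣ.sum-concatMap (arcPair e) (allFin (mult e)) _ ⟩
        ℕΣ.sum (allFin (mult e)) _                              ≡⟨ ℕΣ.sum-cong (allFin (mult e)) (λ _ →
                                                                     pair-entering (F e) (X (hd e)) (X (tl e))) ⟩
        ℕΣ.sum (allFin (mult e)) (λ _ → 𝟙 (crossingEdges X e))  ≡⟨ sumℕ-const (allFin (mult e)) _ ⟩
        length (allFin (mult e)) ℕ.* 𝟙 (crossingEdges X e)      ≡⟨ cong (ℕ._* 𝟙 (crossingEdges X e)) length-allFin ⟩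
        crossingArcs X e                                        ∎
        where
        open ≡-Reasoning
        length-allFin : length (allFin (mult e)) ≡ mult e
        length-allFin = length-tabulate id

    feasible⇒cuts : Feasible I k F → CutsAtLeast (suc k) inD
    feasible⇒cuts feasible X Xr (v , Xv) with any? (λ e → (crossingEdges X e ∧ safe e) ≟ᴮ true)
    ... | yes (e , Ce∧safe) = begin
      suc k                                                       ≡⟨ ℕ.*-identityʳ (suc k) ⟨
      suc k ℕ.* 1                                                 ≡⟨ cong₂ ℕ._*_ mult≡ (cong 𝟙 Ce) ⟨
      crossingArcs X e                                            ≤⟨ ≤-sumℕ (crossingArcs X) (∈-allFin e) ⟩
      ℕΣ.sum (allFin m) (crossingArcs X)                          ≡⟨ indegree-by-edge X ⟨
      indegree inD X                                              ∎
      where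
      open ℕ.≤-Reasoning
      Ce : crossingEdges X e ≡ true
      Ce = ∧-conicalˡ _ _ Ce∧safe
      mult≡ : mult e ≡ suc k
      mult≡ rewrite ∧-conicalʳ (crossingEdges X e) _ Ce∧safe = refl
    ... | no no-safe with countB (crossingEdges X) ≤? k
    ...   | no many = begin
      suc k                                                       ≤⟨ ℕ.≰⇒> many ⟩
      countB (crossingEdges X)                                    ≡⟨ countB≡count (crossingEdges X) ⟩
      count (allFin m) (crossingEdges X)                          ≤⟨ sumℕ-mono (allFin m) mult≥1 ⟩
      ℕΣ.sum (allFin m) (crossingArcs X)                          ≡⟨ indegree-by-edge X ⟨
      indegree inD X                                              ∎
      where
      open ℕ.≤-Reasoning
      mult≥1 : ∀ e → 𝟙 (crossingEdges X e) ≤ crossingArcs X e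
      mult≥1 e = ℕ.m≤n*m _ (mult e) {{mult-nonZero e}}
    ...   | yes few = ⊥-elim (X-disconnected (feasible (crossingEdges X) unsafe few r v))
      where
      unsafe : ∀ e → crossingEdges X e ≡ true → safe e ≡ false
      unsafe e Ce = ¬-not λ safe-e → no-safe (e , cong₂ _∧_ Ce safe-e)
      X-disconnected : ¬ UReach I (F ∖ crossingEdges X) r v
      X-disconnected w with () ← trans (sym Xr) (trans (UReach-constant X (uncrossed X) w) Xv)

    module _ (cost-nonneg : NonNegCost I) where

      module _ {T : ArcSet} (A : SpanningArborescence inD T) where
        arcCostIn : Arc → ℚ
        arcCostIn a = if T a then arcCost a else 0ℚ

        pairCost : (e : Fin m) → Fin (mult e) → ℚ
        pairCost e i = arcCostIn (e , i , true) ℚ.+ (arcCostIn (e , i , false) ℚ.+ 0ℚ)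

        pairCost-zero : ∀ e i j c → i ≢ j → T (e , j , c) ≡ true → pairCost e i ≡ 0ℚ
        pairCost-zero e i j c i≢j Tjc with T (e , i , true) in Tit | T (e , i , false) in Tif
        ... | false | false = refl
        ... | true  | _     = ⊥-elim (i≢j (proj₁ (one-arc-per-edge A e i j true  c Tit Tjc)))
        ... | false | true  = ⊥-elim (i≢j (proj₁ (one-arc-per-edge A e i j false c Tif Tjc)))

        pairCost-bound : ∀ e i c → T (e , i , c) ≡ true → pairCost e i ≤ℚ (if F e then cost e else 0ℚ)
        pairCost-bound e i c Tc rewrite T⊆B A _ Tc with T (e , i , true) in Tt | T (e , i , false) in Tf
        ... | true  | true  with () ← proj₂ (one-arc-per-edge A e i i true false Tt Tf)
        ... | true  | false =
          ℚ.≤-reflexive (trans (cong (cost e ℚ.+_) (ℚ.+-identityˡ 0ℚ)) (ℚ.+-identityʳ (cost e)))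
        ... | false | true  = ℚ.≤-reflexive (trans (ℚ.+-identityˡ _) (ℚ.+-identityʳ (cost e)))
        ... | false | false = cost-nonneg e

        pairCost-empty : ∀ e i → ¬ (T (e , i , true) ≡ true ⊎ T (e , i , false) ≡ true) →
                         pairCost e i ≡ 0ℚ
        pairCost-empty e i none with T (e , i , true) | T (e , i , false)
        ... | false | false = refl
        ... | true  | _     = ⊥-elim (none (inj₁ refl))
        ... | false | true  = ⊥-elim (none (inj₂ refl))

        edgeCost : Fin m → ℚ
        edgeCost e = ℚΣ.sum (arcsOf e) arcCostIn

        edgeCost-by-pair : ∀ e → edgeCost e ≡ ℚΣ.sum (allFin (mult e)) (pairCost e)
        edgeCost-by-pair e = ℚΣ.sum-concatMap (arcPair e) (allFin (mult e)) arcCostIn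

        edgeCost-single : ∀ e i c → T (e , i , c) ≡ true → edgeCost e ≤ℚ (if F e then cost e else 0ℚ)
        edgeCost-single e i c Tc = ℚ.≤-trans
          (ℚ.≤-reflexive (trans (edgeCost-by-pair e)
                                (ℚΣ.sum-unique (allFin⁺ (mult e)) (∈-allFin i)
                                               (λ j j≢i → pairCost-zero e j i c j≢i Tc))))
          (pairCost-bound e i c Tc)

        edgeCost-bound : ∀ e → edgeCost e ≤ℚ (if F e then cost e else 0ℚ)
        edgeCost-bound e with any? (λ i → (T (e , i , true) ≟ᴮ true) ⊎-dec (T (e , i , false) ≟ᴮ true))
        ... | yes (i , inj₁ Tt) = edgeCost-single e i true Tt
        ... | yes (i , inj₂ Tf) = edgeCost-single e i false Tf
        ... | no none = ℚ.≤-trans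
          (ℚ.≤-reflexive (trans (edgeCost-by-pair e)
                                (ℚΣ.sum-zero {xs = allFin (mult e)}
                                  (All.tabulate λ {i} _ → pairCost-empty e i λ Ti → none (i , Ti)))))
          (if-nonneg (F e))
          where
          if-nonneg : ∀ b → 0ℚ ≤ℚ (if b then cost e else 0ℚ)
          if-nonneg true  = cost-nonneg e
          if-nonneg false = ℚ.≤-refl

        costA-bound : costA T ≤ℚ costE I F
        costA-bound = ℚ.≤-trans (ℚ.≤-reflexive (ℚΣ.sum-concatMap arcsOf (allFin m) arcCostIn))
                                (sumℚ-mono (allFin m) edgeCost-bound)

      costA-subadditive : ∀ T T′ → costA (λ a → T a ∨ T′ a) ≤ℚ costA T ℚ.+ costA T′
      costA-subadditive T T′ = ℚ.≤-trans (sumℚ-mono allArcs if-∨)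
        (ℚ.≤-reflexive (ℚΣ.sum-+ allArcs (λ a → if T a then arcCost a else 0ℚ)
                                         (λ a → if T′ a then arcCost a else 0ℚ)))
        where
        if-∨ : ∀ a → (if T a ∨ T′ a then arcCost a else 0ℚ) ≤ℚ
                     (if T a then arcCost a else 0ℚ) ℚ.+ (if T′ a then arcCost a else 0ℚ)
        if-∨ a with T a | T′ a
        ... | true  | true  =
          ℚ.≤-trans (ℚ.≤-reflexive (sym (ℚ.+-identityʳ _))) (ℚ.+-monoʳ-≤ (arcCost a) (cost-nonneg (edgeOf a)))
        ... | true  | false = ℚ.≤-reflexive (sym (ℚ.+-identityʳ _))
        ... | false | true  = ℚ.≤-reflexive (sym (ℚ.+-identityˡ _))
        ... | false | false = ℚ.≤-refl

      record Packing (j : ℕ) (B : ArcSet) : Set where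
        field
          T          : ArcSet
          part       : Arc → Fin (suc j)
          classes    : ∀ i → SpanningArborescence inD (λ a → T a ∧ ⌊ part a ≟ i ⌋)
          T-in-B     : T ⊆ B
          cost-bound : costA T ≤ℚ natℚ (suc j) ℚ.* costE I F

      packing-single : ∀ {B T} → B ⊆ inD → SpanningArborescence B T → Packing zero B
      packing-single {T = T} B⊆D A = record
        { T = T ; part = λ _ → zero
        ; classes = λ { zero → arborescence-resp (λ a → ∧-identityʳ (T a)) (arborescence-mono B⊆D A) }
        ; T-in-B = T⊆B A
        ; cost-bound = ℚ.≤-trans (costA-bound (arborescence-mono B⊆D A))
                                 (ℚ.≤-reflexive (sym (ℚ.*-identityˡ _))) }

      packing-cons : ∀ {j B T₀} → B ⊆ inD → SpanningArborescence B T₀ →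
                     Packing j (B ∖ T₀) → Packing (suc j) B
      packing-cons {j} {B} {T₀} B⊆D A₀ P = record
        { T = T₀∪T₁ ; part = part′ ; classes = classes ; T-in-B = T₀∪T₁⊆B
        ; cost-bound = ℚ.≤-trans (costA-subadditive T₀ T₁) (ℚ.≤-trans
            (ℚ.+-mono-≤ (costA-bound (arborescence-mono B⊆D A₀)) cost-bound₁)
            (ℚ.≤-reflexive (sym (natℚ-suc-* (suc j) (costE I F))))) }
        where
        open Packing P
          renaming ( T to T₁; part to part₁; classes to classes₁
                   ; T-in-B to T₁⊆B∖T₀; cost-bound to cost-bound₁)
        T₀∪T₁ : ArcSet
        T₀∪T₁ a = T₀ a ∨ T₁ a
        part′ : Arc → Fin (suc (suc j))
        part′ a = if T₀ a then zero else suc (part₁ a)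
        disjoint : ∀ a → T₀ a ≡ true → T₁ a ≡ false
        disjoint a T₀a = ¬-not λ T₁a →
          case trans (sym (not-true⇒false (∧-conicalʳ (B a) _ (T₁⊆B∖T₀ a T₁a)))) T₀a of λ ()
        classes : ∀ i → SpanningArborescence inD (λ a → T₀∪T₁ a ∧ ⌊ part′ a ≟ i ⌋)
        classes zero = arborescence-resp first (arborescence-mono B⊆D A₀)
          where
          first : ∀ a → T₀∪T₁ a ∧ ⌊ part′ a ≟ zero ⌋ ≡ T₀ a
          first a with T₀ a
          ... | true  = refl
          ... | false = ∧-zeroʳ (T₁ a)
        classes (suc i) = arborescence-resp later (classes₁ i)
          where
          later : ∀ a → T₀∪T₁ a ∧ ⌊ part′ a ≟ suc i ⌋ ≡ T₁ a ∧ ⌊ part₁ a ≟ i ⌋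
          later a with T₀ a in T₀a
          ... | true rewrite disjoint a T₀a = refl
          ... | false = cong (T₁ a ∧_) (⌊⌋-map′ _ _ (part₁ a ≟ i))
        T₀∪T₁⊆B : T₀∪T₁ ⊆ B
        T₀∪T₁⊆B a e with T₀ a in T₀a
        ... | true  = T⊆B A₀ a T₀a
        ... | false = ∧-conicalˡ (B a) _ (T₁⊆B∖T₀ a e)

      pack : ∀ j B → B ⊆ inD → CutsAtLeast (suc j) B → Packing j B
      pack zero B B⊆D B-cuts with _ , A₀ , _ ← Extraction.extract B zero B-cuts = packing-single B⊆D A₀
      pack (suc j) B B⊆D B-cuts with T₀ , A₀ , residual-cuts ← Extraction.extract B (suc j) B-cuts =
        packing-cons B⊆D A₀ (pack j (B ∖ T₀) (λ a e → B⊆D a (∧-conicalˡ (B a) _ e)) residual-cuts)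

lemma1 : ∀ {n m : ℕ} (I : Instance n m) →
         NoSelfLoops I → NonNegCost I → ConnectedE I (λ _ → true) →
         (k : ℕ) → 1 ≤ k → (F : EdgeSet m) → Feasible I k F → (r : Fin n) →
         let open Digraph I k F in
         Σ[ T ∈ ArcSet ] (IsJArborescence (suc k) r T ×
                           costA T ≤ℚ natℚ (suc k) * costE I F)
lemma1 I _ cost-nonneg _ k _ F feasible r =
  T , (part , λ i → isArborescence (classes i) (λ _ e → e)) , cost-bound
  where
  open Application I k F
  open Rooted r
  open Packing (pack cost-nonneg k inD (λ _ e → e) (feasible⇒cuts feasible))
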